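{- Let $G$ be a 3-uniform hypergraph with vertex set $V$ and $m=7$ edges. Then there is a partition of $V$ into three sets each of which meets at least $\frac{3}{5}m$ edges.
   Context: A 3-uniform hypergraph has a finite vertex set $V$ and $m$ edges that are distinct 3-element subsets of $V$. A set meets an edge if it has nonempty intersection with it. -}

module Defs where

open import Data.Nat using (ℕ; zero; suc)
open import Data.Fin using (Fin; zero; suc; _≟_)
open import Data.Fin.Subset using (Subset; _∩_; Nonempty; ∣_∣)
open import Data.Fin.Subset.Properties using (nonempty?)
open import Data.Vec using (Vec; tabulate; lookup)
open import Data.Product using (_×_)
open import Relation.Binary.PropositionalEquality using (_≡_)
open import Relation.Nullary using (Dec; yes; no)
open import Relation.Nullary.Decidable using (⌊_⌋)
open import Function.Definitions using (Injective)

record Hypergraph3 (n m : ℕ) : Set where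
  field
    edge     : Vec (Subset n) m
    uniform  : ∀ j → ∣ lookup edge j ∣ ≡ 3
    distinct : Injective _≡_ _≡_ (lookup edge)

open Hypergraph3 public

Meets : ∀ {n} → Subset n → Subset n → Set
Meets S e = Nonempty (S ∩ e)

meets? : ∀ {n} (S e : Subset n) → Dec (Meets S e)
meets? S e = nonempty? (S ∩ e)

countFin : ∀ {m} {P : Fin m → Set} → (∀ j → Dec (P j)) → ℕ
countFin {zero}  P? = 0
countFin {suc m} P? with P? zero
... | yes _ = suc (countFin (λ j → P? (suc j)))
... | no  _ = countFin (λ j → P? (suc j))

edgesMet : ∀ {n m} → Hypergraph3 n m → Subset n → ℕ
edgesMet G S = countFin (λ j → meets? S (lookup (edge G) j))

-- A partition of Fin n into three (indexed) parts, given by the map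
-- assigning each vertex its part; part i is the preimage of i.
part : ∀ {n} → (Fin n → Fin 3) → Fin 3 → Subset n
part c i = tabulate (λ v → ⌊ c v ≟ i ⌋)

-- Two vertices lying in no common edge can be merged: every edge stays a 3-set and a colouring
-- of the merged hypergraph pulls back, with the same edges missed. So we may assume that any two
-- vertices lie in a common edge. Naming vertices greedily, starting with the three of one edge,
-- either all vertices get one of k ≤ 6 names, or seven named vertices are pairwise covered by the
-- seven edges. In every case a colouring with each class missing at most two edges is found by
-- double counting over the possible (labelled) shapes of an edge: for k = 4, 5 the classes are
-- vertices or pairs avoided by at most two edges; for k = 6 a class pairs one vertex of the first
-- edge with one of the other three vertices, chosen by Hall's theorem on a 3 × 3 grid; for seven
-- names one fixed colouring works. Each per-edge inequality is decided by enumerating all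
-- labelled triples.
module Submission where

open import Defs
open import Data.Bool.Base using (T; if_then_else_)
open import Data.Bool.Properties using (T?)
open import Data.Fin.Base using (Fin; zero; suc; toℕ; fromℕ; inject₁; _↑ʳ_; _↑ˡ_; punchIn; combine; remQuot)
open import Data.Fin.Patterns using (0F; 1F; 2F; 3F; 4F; 5F; 6F)
open import Data.Fin.Permutation using (Permutation′; _⟨$⟩ʳ_; _⟨$⟩ˡ_; inverseˡ; id; transpose; _∘ₚ_)
open import Data.Fin.Properties
  using (any?; all?; _≟_; toℕ-injective; fromℕ≢inject₁; inject₁-injective; punchInᵢ≢i; remQuot-combine)
open import Data.Fin.Subset using (Subset; _∈_; _∉_; _-_; ∣_∣; inside; outside)
open import Data.Fin.Subset.Properties using (anySubset?; p─⊥≡p; p─q⊆p; x∈p∩q⁺)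
open import Data.List.Base as List using (List; []; _∷_; length; filter; cartesianProduct; allFin)
import Data.List.Membership.DecPropositional as DecMembership
open import Data.List.Relation.Unary.All as All using (All; []; _∷_)
open import Data.Nat.Base using (ℕ; zero; suc; _+_; _*_; _≤_; _<_; _⊔_; z≤n; s≤s)
open import Data.Nat.Induction using (<-wellFounded)
open import Data.Nat.Properties hiding (_≟_)
open import Algebra.Properties.Semiring.Sum +-*-semiring
  using (sum; sum-syntax; sum-remove; sum-cong-≗; ∑-distrib-+; ∑-comm; *-distribˡ-sum)
open import Data.Product using (_×_; _,_; ∃; ∃₂; proj₁; proj₂; uncurry)
open import Data.Product.Properties using (≡-dec)
open import Data.Sum using (_⊎_; inj₁; inj₂)
open import Data.Vec.Base using (_∷_; lookup; tabulate; here; there)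
import Data.Vec.Functional as Vector
open import Data.Vec.Properties using (lookup∘tabulate; lookup⇒[]=)
open import Function.Base using (_∘_)
open import Function.Definitions using (Injective)
open import Induction.WellFounded using (Acc; acc)
open import Relation.Binary.Definitions using (tri<; tri≈; tri>)
open import Relation.Binary.PropositionalEquality
open import Relation.Nullary.Decidable
  using (Dec; yes; no; does; isYes; True; ¬?; _×-dec_; _⊎-dec_; _→-dec_; map′; from-yes;
         toWitness; fromWitness; decidable-stable; dec-true; isYes≗does)
open import Relation.Nullary.Negation using (¬_; contradiction)

sum-mono-≤ : ∀ {n} {f g : Fin n → ℕ} → (∀ i → f i ≤ g i) → sum f ≤ sum g
sum-mono-≤ {zero}  f≤g = z≤n
sum-mono-≤ {suc n} f≤g = +-mono-≤ (f≤g zero) (sum-mono-≤ (f≤g ∘ suc))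

sum-mono-< : ∀ {n} {f g : Fin n → ℕ} → (∀ i → f i ≤ g i) → ∀ i → f i < g i → sum f < sum g
sum-mono-< f≤g zero    fi<gi = +-mono-<-≤ fi<gi (sum-mono-≤ (f≤g ∘ suc))
sum-mono-< f≤g (suc i) fi<gi = +-mono-≤-< (f≤g zero) (sum-mono-< (f≤g ∘ suc) i fi<gi)

sum-const : ∀ n k → ∑[ i < n ] k ≡ n * k
sum-const zero    k = refl
sum-const (suc n) k = cong (k +_) (sum-const n k)

f≤sum : ∀ {n} (f : Fin n → ℕ) i → f i ≤ sum f
f≤sum f zero    = m≤m+n (f zero) _
f≤sum f (suc i) = ≤-trans (f≤sum (f ∘ suc) i) (m≤n+m _ (f zero))

∑-+-* : ∀ {m} a b (f g : Fin m → ℕ) → ∑[ j < m ] (a * f j + b * g j) ≡ a * sum f + b * sum g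
∑-+-* a b f g = trans (∑-distrib-+ (λ j → a * f j) (λ j → b * g j))
                      (sym (cong₂ _+_ (*-distribˡ-sum a f) (*-distribˡ-sum b g)))

pigeonhole-sum : ∀ {n} b (f : Fin n → ℕ) → sum f < n * suc b → ∃ λ i → f i ≤ b
pigeonhole-sum {n} b f small with any? (λ i → f i ≤? b)
... | yes found = found
... | no none   = contradiction large (<⇒≱ small)
  where
  large : n * suc b ≤ sum f
  large = subst (_≤ sum f) (sum-const n (suc b)) (sum-mono-≤ λ i → ≰⇒> λ fi≤b → none (i , fi≤b))

double-count-≤ : ∀ {L m} (g : Fin L → Fin m → ℕ) c → (∀ j → ∑[ ℓ < L ] g ℓ j ≤ c) →
                 ∑[ ℓ < L ] ∑[ j < m ] g ℓ j ≤ m * c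
double-count-≤ {L} {m} g c bound = begin
  ∑[ ℓ < L ] ∑[ j < m ] g ℓ j ≡⟨ ∑-comm g ⟩
  ∑[ j < m ] ∑[ ℓ < L ] g ℓ j ≤⟨ sum-mono-≤ bound ⟩
  ∑[ j < m ] c                ≡⟨ sum-const m c ⟩
  m * c                       ∎
  where open ≤-Reasoning

bound-by-certificate : ∀ {m} (c μ : Fin m → ℕ) B w L b → (∀ j → c j + w * μ j ≤ B) →
                       L ≤ sum c → m * B < L + w * suc b → sum μ ≤ b
bound-by-certificate {m} c μ B w L b certificate L≤∑c small =
  ≤-pred (*-cancelˡ-< w (sum μ) (suc b) (+-cancelˡ-< (sum c) _ _ (begin-strict
    sum c + w * sum μ             ≡⟨ cong (sum c +_) (*-distribˡ-sum w μ) ⟩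
    sum c + ∑[ j < m ] (w * μ j)  ≡⟨ sym (∑-distrib-+ c _) ⟩
    ∑[ j < m ] (c j + w * μ j)    ≤⟨ sum-mono-≤ certificate ⟩
    ∑[ j < m ] B                  ≡⟨ sum-const m B ⟩
    m * B                         <⟨ small ⟩
    L + w * suc b                 ≤⟨ +-monoˡ-≤ _ L≤∑c ⟩
    sum c + w * suc b             ∎)))
  where open ≤-Reasoning

𝟙 : ∀ {p} {P : Set p} → Dec P → ℕ
𝟙 P? = if does P? then 1 else 0

𝟙≤1 : ∀ {p} {P : Set p} (P? : Dec P) → 𝟙 P? ≤ 1
𝟙≤1 (yes _) = ≤-refl
𝟙≤1 (no _)  = z≤n

𝟙-yes : ∀ {p} {P : Set p} (P? : Dec P) → P → 𝟙 P? ≡ 1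
𝟙-yes (yes _) _ = refl
𝟙-yes (no ¬p) p = contradiction p ¬p

𝟙-no : ∀ {p} {P : Set p} (P? : Dec P) → ¬ P → 𝟙 P? ≡ 0
𝟙-no (yes p) ¬p = contradiction p ¬p
𝟙-no (no _)  _  = refl

Triple : Set → Set
Triple A = A × A × A

infix 9 _‼_
_‼_ : ∀ {A} → Triple A → Fin 3 → A
(a , b , c) ‼ 0F = a
(a , b , c) ‼ 1F = b
(a , b , c) ‼ 2F = c

map₃ : ∀ {A B} → (A → B) → Triple A → Triple B
map₃ f (a , b , c) = f a , f b , f c

‼-map₃ : ∀ {A B} (f : A → B) t s → map₃ f t ‼ s ≡ f (t ‼ s)
‼-map₃ f t 0F = refl
‼-map₃ f t 1F = refl
‼-map₃ f t 2F = refl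

infix 4 _∈₃_ _∈₃?_ _≟₃_
_∈₃_ : ∀ {A} → A → Triple A → Set
x ∈₃ t = ∃ λ s → t ‼ s ≡ x

_∈₃?_ : ∀ {n} (x : Fin n) t → Dec (x ∈₃ t)
x ∈₃? t = any? λ s → t ‼ s ≟ x

∈₃-map₃ : ∀ {A B} (f : A → B) {x t} → x ∈₃ t → f x ∈₃ map₃ f t
∈₃-map₃ f {t = t} (s , refl) = s , ‼-map₃ f t s

_≟₃_ : ∀ {n} (t t′ : Triple (Fin n)) → Dec (t ≡ t′)
_≟₃_ = ≡-dec _≟_ (≡-dec _≟_ _≟_)

Distinct₃ : ∀ {A} → Triple A → Set
Distinct₃ t = ∀ s s′ → s ≢ s′ → t ‼ s ≢ t ‼ s′

distinct₃? : ∀ {n} (t : Triple (Fin n)) → Dec (Distinct₃ t)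
distinct₃? t = all? λ s → all? λ s′ → ¬? (s ≟ s′) →-dec ¬? (t ‼ s ≟ t ‼ s′)

distinct₃ : ∀ {A} {a b c : A} → a ≢ b → a ≢ c → b ≢ c → Distinct₃ (a , b , c)
distinct₃ a≢b a≢c b≢c 0F 0F s≢s′ = contradiction refl s≢s′
distinct₃ a≢b a≢c b≢c 0F 1F _    = a≢b
distinct₃ a≢b a≢c b≢c 0F 2F _    = a≢c
distinct₃ a≢b a≢c b≢c 1F 0F _    = a≢b ∘ sym
distinct₃ a≢b a≢c b≢c 1F 1F s≢s′ = contradiction refl s≢s′
distinct₃ a≢b a≢c b≢c 1F 2F _    = b≢c
distinct₃ a≢b a≢c b≢c 2F 0F _    = a≢c ∘ sym
distinct₃ a≢b a≢c b≢c 2F 1F _    = b≢c ∘ sym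
distinct₃ a≢b a≢c b≢c 2F 2F s≢s′ = contradiction refl s≢s′

AllDistinct : ∀ {A m} → (Fin m → Triple A) → Set
AllDistinct es = ∀ j → Distinct₃ (es j)

Vertex : ∀ {A m} → (Fin m → Triple A) → A → Set
Vertex es x = ∃ λ j → x ∈₃ es j

Adjacent : ∀ {A m} → (Fin m → Triple A) → A → A → Set
Adjacent es x y = ∃ λ j → x ∈₃ es j × y ∈₃ es j

adjacent? : ∀ {n m} (es : Fin m → Triple (Fin n)) x y → Dec (Adjacent es x y)
adjacent? es x y = any? λ j → x ∈₃? es j ×-dec y ∈₃? es j

adjacent-sym : ∀ {A m} {es : Fin m → Triple A} {x y} → Adjacent es x y → Adjacent es y x
adjacent-sym (j , x∈ , y∈) = j , y∈ , x∈

PairwiseAdjacent : ∀ {A m} → (Fin m → Triple A) → Set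
PairwiseAdjacent es = ∀ {x y} → Vertex es x → Vertex es y → x ≢ y → Adjacent es x y

Hits : ∀ {A} → (A → Fin 3) → Fin 3 → Triple A → Set
Hits κ i t = ∃ λ s → κ (t ‼ s) ≡ i

hits? : ∀ {A} (κ : A → Fin 3) i t → Dec (Hits κ i t)
hits? κ i t = any? λ s → κ (t ‼ s) ≟ i

miss : ∀ {A} → (A → Fin 3) → Fin 3 → Triple A → ℕ
miss κ i t = 𝟙 (¬? (hits? κ i t))

MissesAtMost : ∀ {A m} → ℕ → (A → Fin 3) → (Fin m → Triple A) → Set
MissesAtMost {m = m} b κ es = ∀ i → ∑[ j < m ] miss κ i (es j) ≤ b

Splittable : ∀ {A m} → (Fin m → Triple A) → Set
Splittable {A} es = ∃ λ (κ : A → Fin 3) → MissesAtMost 2 κ es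

avoid : ∀ {n} → List (Fin n) → Triple (Fin n) → ℕ
avoid ℓs t = 𝟙 (All.all? (λ ℓ → ¬? (ℓ ∈₃? t)) ℓs)

miss-≤-avoid : ∀ {n} {κ : Fin n → Fin 3} {i ℓs} → All (λ ℓ → κ ℓ ≡ i) ℓs →
               ∀ t → miss κ i t ≤ avoid ℓs t
miss-≤-avoid {κ = κ} {i} {ℓs} coloured t with All.all? (λ ℓ → ¬? (ℓ ∈₃? t)) ℓs
... | yes _       = 𝟙≤1 (¬? (hits? κ i t))
... | no ¬avoids = ≤-reflexive (𝟙-no (¬? (hits? κ i t)) λ ¬hits →
  ¬avoids (All.map (λ κℓ≡i (s , eq) → ¬hits (s , trans (cong κ eq) κℓ≡i)) coloured))

misses-≤-avoiding : ∀ {n m} (κ : Fin n → Fin 3) {i ℓs} → All (λ ℓ → κ ℓ ≡ i) ℓs →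
                    (es : Fin m → Triple (Fin n)) → ∑[ j < m ] miss κ i (es j) ≤ ∑[ j < m ] avoid ℓs (es j)
misses-≤-avoiding κ coloured es = sum-mono-≤ λ j → miss-≤-avoid coloured (es j)

-- Merging non-adjacent vertices

module _ {n : ℕ} where

  merge : Fin n → Fin n → Fin n → Fin n
  merge y x z = if does (z ≟ y) then x else z

  merge-collision : ∀ {x y u w} → merge y x u ≡ merge y x w →
                    u ≡ w ⊎ (u ≡ y × x ≡ w) ⊎ (u ≡ x × w ≡ y)
  merge-collision {x} {y} {u} {w} eq with u ≟ y | w ≟ y
  ... | yes u≡y | yes w≡y = inj₁ (trans u≡y (sym w≡y))
  ... | yes u≡y | no _    = inj₂ (inj₁ (u≡y , eq))
  ... | no _    | yes w≡y = inj₂ (inj₂ (eq , w≡y))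
  ... | no _    | no _    = inj₁ eq

  merge-distinct : ∀ {x y} {t : Triple (Fin n)} → ¬ (x ∈₃ t × y ∈₃ t) →
                   Distinct₃ t → Distinct₃ (map₃ (merge y x) t)
  merge-distinct {x} {y} {t} notBoth distinct s s′ s≢s′ eq
    with merge-collision (trans (sym (‼-map₃ (merge y x) t s)) (trans eq (‼-map₃ (merge y x) t s′)))
  ... | inj₁ same              = distinct s s′ s≢s′ same
  ... | inj₂ (inj₁ (ys , xs′)) = notBoth ((s′ , sym xs′) , (s , ys))
  ... | inj₂ (inj₂ (xs , ys′)) = notBoth ((s , xs) , (s′ , ys′))

  merge-≤ : ∀ {x y} → toℕ x < toℕ y → ∀ z → toℕ (merge y x z) ≤ toℕ z
  merge-≤ {x} {y} x<y z with z ≟ y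
  ... | yes refl = <⇒≤ x<y
  ... | no _     = ≤-refl

  merge-< : ∀ {x y} → toℕ x < toℕ y → toℕ (merge y x y) < toℕ y
  merge-< {x} {y} x<y with y ≟ y
  ... | yes _   = x<y
  ... | no y≢y = contradiction refl y≢y

  weight : ∀ {m} → (Fin m → Triple (Fin n)) → ℕ
  weight {m} es = ∑[ j < m ] ∑[ s < 3 ] toℕ (es j ‼ s)

  weight-merge : ∀ {m} {es : Fin m → Triple (Fin n)} {x y} → toℕ x < toℕ y → Vertex es y →
                 weight (map₃ (merge y x) ∘ es) < weight es
  weight-merge {es = es} {x} {y} x<y (j , s , refl) =
    sum-mono-< (λ j → sum-mono-≤ (slot-≤ j)) j (sum-mono-< (slot-≤ j) s merged-slot)
    where
    slot-≤ : ∀ j s → toℕ (map₃ (merge y x) (es j) ‼ s) ≤ toℕ (es j ‼ s)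
    slot-≤ j s rewrite ‼-map₃ (merge y x) (es j) s = merge-≤ x<y (es j ‼ s)
    merged-slot : toℕ (map₃ (merge y x) (es j) ‼ s) < toℕ y
    merged-slot rewrite ‼-map₃ (merge y x) (es j) s = merge-< x<y

  NonAdjacentPair : ∀ {m} → (Fin m → Triple (Fin n)) → Set
  NonAdjacentPair es = ∃₂ λ j s → ∃₂ λ j′ s′ →
    toℕ (es j ‼ s) < toℕ (es j′ ‼ s′) × ¬ Adjacent es (es j ‼ s) (es j′ ‼ s′)

  non-adjacent-pair? : ∀ {m} (es : Fin m → Triple (Fin n)) → Dec (NonAdjacentPair es)
  non-adjacent-pair? es = any? λ j → any? λ s → any? λ j′ → any? λ s′ →
    toℕ (es j ‼ s) <? toℕ (es j′ ‼ s′) ×-dec ¬? (adjacent? es (es j ‼ s) (es j′ ‼ s′))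

  pairwise-adjacent : ∀ {m} (es : Fin m → Triple (Fin n)) → ¬ NonAdjacentPair es → PairwiseAdjacent es
  pairwise-adjacent es none (j , s , refl) (j′ , s′ , refl) x≢y
    with <-cmp (toℕ (es j ‼ s)) (toℕ (es j′ ‼ s′))
  ... | tri< x<y _ _ = decidable-stable (adjacent? es _ _) λ ¬adj → none (j , s , j′ , s′ , x<y , ¬adj)
  ... | tri≈ _ x≡y _ = contradiction (toℕ-injective x≡y) x≢y
  ... | tri> _ _ y<x =
    adjacent-sym (decidable-stable (adjacent? es _ _) λ ¬adj → none (j′ , s′ , j , s , y<x , ¬adj))

  Folding : ∀ {m} → (Fin m → Triple (Fin n)) → Set
  Folding es = ∃ λ (f : Fin n → Fin n) → AllDistinct (map₃ f ∘ es) × PairwiseAdjacent (map₃ f ∘ es)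

  -- Each merge sends the larger of the two vertices to the smaller one, decreasing the weight.
  folding : ∀ {m} (es : Fin m → Triple (Fin n)) → AllDistinct es → Folding es
  folding es distinct = go es distinct (<-wellFounded (weight es))
    where
    go : ∀ {m} (es : Fin m → Triple (Fin n)) → AllDistinct es → Acc _<_ (weight es) → Folding es
    go es distinct (acc smaller) with non-adjacent-pair? es
    ... | no none = (λ x → x) , distinct , pairwise-adjacent es none
    ... | yes (j , s , j′ , s′ , x<y , ¬adj)
      with go (map₃ (merge (es j′ ‼ s′) (es j ‼ s)) ∘ es)
              (λ i → merge-distinct (λ both → ¬adj (i , both)) (distinct i))
              (smaller (weight-merge {es = es} x<y (j′ , s′ , refl)))
    ...   | f , distinct′ , pairwise′ = f ∘ merge (es j′ ‼ s′) (es j ‼ s) , distinct′ , pairwise′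

-- Naming the vertices of a hypergraph

-- A triple of labels in Fin (suc k): the names are Fin k and fromℕ k labels every unnamed vertex.

RepeatsOnlyUnnamed : ∀ {k} → Triple (Fin (suc k)) → Set
RepeatsOnlyUnnamed {k} t = ∀ s s′ → s ≢ s′ → t ‼ s ≡ t ‼ s′ → t ‼ s ≡ fromℕ k

repeats-only-unnamed? : ∀ {k} (t : Triple (Fin (suc k))) → Dec (RepeatsOnlyUnnamed t)
repeats-only-unnamed? {k} t =
  all? λ s → all? λ s′ → ¬? (s ≟ s′) →-dec (t ‼ s ≟ t ‼ s′ →-dec t ‼ s ≟ fromℕ k)

AllNamed : ∀ {k} → Triple (Fin (suc k)) → Set
AllNamed {k} t = ∀ s → t ‼ s ≢ fromℕ k

Proper : ∀ {k} → Triple (Fin (suc k)) → Set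
Proper t = Distinct₃ t × AllNamed t

proper? : ∀ {k} (t : Triple (Fin (suc k))) → Dec (Proper t)
proper? {k} t = distinct₃? t ×-dec all? λ s → ¬? (t ‼ s ≟ fromℕ k)

Covers : ∀ {k m} → (Fin m → Triple (Fin (suc k))) → Set
Covers {k} es = ∀ (i i′ : Fin k) → i ≢ i′ → Adjacent es (inject₁ i) (inject₁ i′)

module Labelling {n m} (es : Fin (suc m) → Triple (Fin n)) where

  -- The first edge keeps the last three names; with six names they are the rows of colour₆.
  record Naming (e : ℕ) : Set where
    field
      name      : Fin (e + 3) → Fin n
      injective : Injective _≡_ _≡_ name
      vertex    : ∀ i → Vertex es (name i)
      first     : ∀ s → name (e ↑ʳ s) ≡ es 0F ‼ s

  open Naming public

  Named : ∀ {e} → Naming e → Fin n → Set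
  Named N x = ∃ λ i → name N i ≡ x

  Complete : ∀ {e} → Naming e → Set
  Complete N = ∀ {x} → Vertex es x → Named N x

  first-edge-naming : AllDistinct es → Naming 0
  first-edge-naming distinct = record
    { name      = es 0F ‼_
    ; injective = λ {s} {s′} eq → decidable-stable (s ≟ s′) λ s≢s′ → distinct 0F s s′ s≢s′ eq
    ; vertex    = λ s → 0F , s , refl
    ; first     = λ s → refl
    }

  extend : ∀ {e} (N : Naming e) {x} → Vertex es x → ¬ Named N x → Naming (suc e)
  extend N {x} vx x∉ = record
    { name      = x Vector.∷ name N
    ; injective = injective′
    ; vertex    = λ { zero → vx ; (suc i) → vertex N i }
    ; first     = first N
    }
    where
    injective′ : Injective _≡_ _≡_ (x Vector.∷ name N)
    injective′ {zero}  {zero}   _  = refl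
    injective′ {zero}  {suc i′} eq = contradiction (i′ , sym eq) x∉
    injective′ {suc i} {zero}   eq = contradiction (i , eq) x∉
    injective′ {suc i} {suc i′} eq = cong suc (injective N eq)

  complete-or-extensible : ∀ {e} (N : Naming e) → Complete N ⊎ ∃ λ x → Vertex es x × ¬ Named N x
  complete-or-extensible N with any? (λ j → any? λ s → ¬? (any? λ i → name N i ≟ es j ‼ s))
  ... | yes (j , s , unnamed) = inj₂ (es j ‼ s , (j , s , refl) , unnamed)
  ... | no none = inj₁ λ { (j , s , refl) →
          decidable-stable (any? λ i → name N i ≟ es j ‼ s) λ unnamed → none (j , s , unnamed) }

  label : ∀ {e} → Naming e → Fin n → Fin (suc (e + 3))
  label {e} N x with any? (λ i → name N i ≟ x)
  ... | yes (i , _) = inject₁ i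
  ... | no _        = fromℕ (e + 3)

  label-name : ∀ {e} (N : Naming e) i → label N (name N i) ≡ inject₁ i
  label-name N i with any? (λ i′ → name N i′ ≟ name N i)
  ... | yes (i′ , eq) = cong inject₁ (injective N eq)
  ... | no none       = contradiction (i , refl) none

  label-first : ∀ {e} (N : Naming e) s → label N (es 0F ‼ s) ≡ inject₁ (e ↑ʳ s)
  label-first N s = subst (λ x → label N x ≡ inject₁ (_ ↑ʳ s)) (first N s) (label-name N (_ ↑ʳ s))

  label-injective : ∀ {e} (N : Naming e) {x y} → label N x ≡ label N y → x ≡ y ⊎ label N x ≡ fromℕ (e + 3)
  label-injective N {x} {y} eq with any? (λ i → name N i ≟ x) | any? (λ i → name N i ≟ y)
  ... | yes (i , refl) | yes (i′ , refl) = inj₁ (cong (name N) (inject₁-injective eq))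
  ... | yes _          | no _            = contradiction (sym eq) fromℕ≢inject₁
  ... | no _           | _               = inj₂ refl

  labelled : ∀ {e} → Naming e → Fin (suc m) → Triple (Fin (suc (e + 3)))
  labelled N = map₃ (label N) ∘ es

  labelled-repeats-only-unnamed : ∀ {e} (N : Naming e) → AllDistinct es → ∀ j → RepeatsOnlyUnnamed (labelled N j)
  labelled-repeats-only-unnamed N distinct j s s′ s≢s′ eq
    rewrite ‼-map₃ (label N) (es j) s | ‼-map₃ (label N) (es j) s′
    with label-injective N eq
  ... | inj₁ same    = contradiction same (distinct j s s′ s≢s′)
  ... | inj₂ unnamed = unnamed

  labelled-all-named : ∀ {e} (N : Naming e) → Complete N → ∀ j → AllNamed (labelled N j)
  labelled-all-named N complete j s
    rewrite ‼-map₃ (label N) (es j) s with complete (j , s , refl)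
  ... | i , eq rewrite sym eq | label-name N i = fromℕ≢inject₁ ∘ sym

  labelled-proper : ∀ {e} (N : Naming e) → AllDistinct es → Complete N → ∀ j → Proper (labelled N j)
  labelled-proper N distinct complete j =
    (λ s s′ s≢s′ eq →
       labelled-all-named N complete j s (labelled-repeats-only-unnamed N distinct j s s′ s≢s′ eq)) ,
    labelled-all-named N complete j

  labelled-covers : ∀ {e} (N : Naming e) → PairwiseAdjacent es → Covers (labelled N)
  labelled-covers N adjacent i i′ i≢i′ with adjacent (vertex N i) (vertex N i′) (i≢i′ ∘ injective N)
  ... | j , ∈j , ∈j′ = j , subst (_∈₃ labelled N j) (label-name N i) (∈₃-map₃ (label N) ∈j)
                         , subst (_∈₃ labelled N j) (label-name N i′) (∈₃-map₃ (label N) ∈j′)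

∀-triple? : ∀ {n} {P : Triple (Fin n) → Set} → (∀ t → Dec (P t)) → Dec (∀ t → P t)
∀-triple? P? = map′ (λ h t → h (proj₁ t) (proj₁ (proj₂ t)) (proj₂ (proj₂ t))) (λ h a b c → h (a , b , c))
  (all? λ a → all? λ b → all? λ c → P? (a , b , c))

pairsIn : ∀ {k} → List (Fin k × Fin k) → Triple (Fin (suc k)) → ℕ
pairsIn []              t = 0
pairsIn ((a , b) ∷ abs) t = 𝟙 (inject₁ a ∈₃? t ×-dec inject₁ b ∈₃? t) + pairsIn abs t

covered-pairs : ∀ {k m} {es : Fin m → Triple (Fin (suc k))} → Covers es →
                (abs : List (Fin k × Fin k)) → All (uncurry _≢_) abs → length abs ≤ ∑[ j < m ] pairsIn abs (es j)
covered-pairs covers []              []             = z≤n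
covered-pairs {es = es} covers ((a , b) ∷ abs) (a≢b ∷ distinct) with covers a b a≢b
... | j , a∈ , b∈ = subst (suc (length abs) ≤_) (sym (∑-distrib-+ covering (pairsIn abs ∘ es)))
  (+-mono-≤ (subst (_≤ sum covering) (𝟙-yes (inject₁ a ∈₃? es j ×-dec inject₁ b ∈₃? es j) (a∈ , b∈))
                   (f≤sum covering j))
            (covered-pairs covers abs distinct))
  where
  covering : Fin _ → ℕ
  covering j = 𝟙 (inject₁ a ∈₃? es j ×-dec inject₁ b ∈₃? es j)

-- Hall's theorem for a 3 × 3 grid

-- Hall's condition for a 3 × 3 bipartite graph: no row or column is empty, and every 2 × 2 minor has
-- an edge (so no two rows see just one column).
HallCondition : (Fin 3 → Fin 3 → Set) → Set
HallCondition R = (∀ x → ∃ (R x)) × (∀ u → ∃ λ x → R x u) ×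
                  (∀ x u → ∃₂ λ a b → R (punchIn x a) (punchIn u b))

hall-condition-map : ∀ {R S : Fin 3 → Fin 3 → Set} → (∀ {x u} → R x u → S x u) →
                     HallCondition R → HallCondition S
hall-condition-map f (rows , cols , blocks) =
  (λ x → let u , r = rows x in u , f r) ,
  (λ u → let x , r = cols u in x , f r) ,
  (λ x u → let a , b , r = blocks x u in a , b , f r)

permutation₃ : Fin 6 → Permutation′ 3
permutation₃ 0F = id
permutation₃ 1F = transpose 0F 1F
permutation₃ 2F = transpose 0F 2F
permutation₃ 3F = transpose 1F 2F
permutation₃ 4F = transpose 0F 1F ∘ₚ transpose 1F 2F
permutation₃ 5F = transpose 1F 2F ∘ₚ transpose 0F 1F

∀-subset? : ∀ {n} {P : Subset n → Set} → (∀ g → Dec (P g)) → Dec (∀ g → P g)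
∀-subset? P? = map′ (λ none g → decidable-stable (P? g) λ ¬p → none (g , ¬p)) (λ all (g , ¬p) → ¬p (all g))
  (¬? (anySubset? (¬? ∘ P?)))

-- A subset of Fin 9 encodes a 3 × 3 Boolean matrix, which makes all of them enumerable.
Cell : Subset 9 → Fin 3 → Fin 3 → Set
Cell g x u = T (lookup g (combine x u))

cell? : ∀ g x u → Dec (Cell g x u)
cell? g x u = T? (lookup g (combine x u))

hall-condition? : ∀ g → Dec (HallCondition (Cell g))
hall-condition? g = (all? λ x → any? (cell? g x)) ×-dec (all? λ u → any? λ x → cell? g x u)
  ×-dec (all? λ x → all? λ u → any? λ a → any? λ b → cell? g (punchIn x a) (punchIn u b))

hall-for-subsets : ∀ g → HallCondition (Cell g) → ∃ λ p → ∀ x → Cell g x (permutation₃ p ⟨$⟩ʳ x)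
hall-for-subsets = from-yes (∀-subset? λ g → hall-condition? g →-dec
  any? λ p → all? λ x → cell? g x (permutation₃ p ⟨$⟩ʳ x))

module _ {R : Fin 3 → Fin 3 → Set} (R? : ∀ x u → Dec (R x u)) where

  private
    grid : Subset 9
    grid = tabulate λ c → isYes (uncurry R? (remQuot 3 c))

    cell≡ : ∀ x u → Cell grid x u ≡ True (R? x u)
    cell≡ x u = trans (cong T (lookup∘tabulate (λ c → isYes (uncurry R? (remQuot 3 c))) (combine x u)))
                      (cong (λ c → True (uncurry R? c)) (remQuot-combine x u))

  hall₃ : HallCondition R → ∃ λ (π : Permutation′ 3) → ∀ x → R x (π ⟨$⟩ʳ x)
  hall₃ condition =
    let p , matched = hall-for-subsets grid
          (hall-condition-map (λ {x} {u} r → subst (λ A → A) (sym (cell≡ x u)) (fromWitness r)) condition)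
    in permutation₃ p , λ x → toWitness (subst (λ A → A) (cell≡ x _) (matched x))

-- Three to seven names

colour₃ : Fin 4 → Fin 3
colour₃ 0F = 0F
colour₃ 1F = 1F
colour₃ 2F = 2F
colour₃ 3F = 0F

colour₃-misses-nothing : ∀ {m} (es : Fin m → Triple (Fin 4)) → (∀ j → Proper (es j)) →
                         MissesAtMost 0 colour₃ es
colour₃-misses-nothing {m} es proper i =
  ≤-trans (sum-mono-≤ λ j → hits-every-colour (es j) (proper j) i) (≤-reflexive (trans (sum-const m 0) (*-zeroʳ m)))
  where
  hits-every-colour : ∀ t → Proper t → ∀ i → miss colour₃ i t ≤ 0
  hits-every-colour = from-yes (∀-triple? λ t → proper? t →-dec all? λ i → miss colour₃ i t ≤? 0)

colour₄ : Fin 4 → Fin 4 → Fin 5 → Fin 3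
colour₄ a b ℓ = if does (ℓ ≟ inject₁ a) then 0F else if does (ℓ ≟ inject₁ b) then 1F else 2F

colour₄-first : ∀ a b → colour₄ a b (inject₁ a) ≡ 0F
colour₄-first = from-yes (all? λ a → all? λ b → colour₄ a b (inject₁ a) ≟ 0F)

colour₄-second : ∀ a b → a ≢ b → colour₄ a b (inject₁ b) ≡ 1F
colour₄-second = from-yes (all? λ a → all? λ b → ¬? (a ≟ b) →-dec colour₄ a b (inject₁ b) ≟ 1F)

colour₄-third : ∀ a b → a ≢ b → ∀ t → Proper t → miss (colour₄ a b) 2F t ≤ 0
colour₄-third = from-yes (all? λ a → all? λ b → ¬? (a ≟ b) →-dec
  ∀-triple? λ t → proper? t →-dec miss (colour₄ a b) 2F t ≤? 0)

module _ (es : Fin 7 → Triple (Fin 5)) (proper : ∀ j → Proper (es j)) where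

  private
    missing : Fin 4 → ℕ
    missing ℓ = ∑[ j < 7 ] avoid (inject₁ ℓ ∷ []) (es j)

    avoids-one : ∀ t → Proper t → ∑[ ℓ < 4 ] avoid (inject₁ ℓ ∷ []) t ≤ 1
    avoids-one = from-yes (∀-triple? λ t → proper? t →-dec ∑[ ℓ < 4 ] avoid (inject₁ ℓ ∷ []) t ≤? 1)

    total : sum missing ≤ 7
    total = double-count-≤ (λ ℓ j → avoid (inject₁ ℓ ∷ []) (es j)) 1 λ j → avoids-one (es j) (proper j)

    colouring : ∀ a b → a ≢ b → missing a ≤ 2 → missing b ≤ 2 → MissesAtMost 2 (colour₄ a b) es
    colouring a b a≢b a-few b-few 0F =
      ≤-trans (misses-≤-avoiding (colour₄ a b) (colour₄-first a b ∷ []) es) a-few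
    colouring a b a≢b a-few b-few 1F =
      ≤-trans (misses-≤-avoiding (colour₄ a b) (colour₄-second a b a≢b ∷ []) es) b-few
    colouring a b a≢b a-few b-few 2F = ≤-trans (sum-mono-≤ λ j → colour₄-third a b a≢b (es j) (proper j)) z≤n

  splittable₄ : Splittable es
  splittable₄ =
    let a , a-few = pigeonhole-sum 2 missing (≤-<-trans total (from-yes (7 <? 12)))
        t , b-few = pigeonhole-sum 2 (missing ∘ punchIn a)
          (≤-<-trans (≤-trans (m≤n+m _ (missing a)) (≤-trans (≤-reflexive (sym (sum-remove missing))) total))
                     (from-yes (7 <? 9)))
    in colour₄ a (punchIn a t) , colouring a (punchIn a t) (punchInᵢ≢i a t ∘ sym) a-few b-few

pairing : Fin 3 → (Fin 4 × Fin 4) × (Fin 4 × Fin 4)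
pairing 0F = (0F , 1F) , (2F , 3F)
pairing 1F = (0F , 2F) , (1F , 3F)
pairing 2F = (0F , 3F) , (1F , 2F)

classes : Fin 5 → Fin 3 → List (Fin 6) × List (Fin 6)
classes a k with pairing k
... | (p , q) , (p′ , q′) = (other p ∷ other q ∷ []) , (other p′ ∷ other q′ ∷ [])
  where
  other : Fin 4 → Fin 6
  other = inject₁ ∘ punchIn a

colour₅ : Fin 5 → Fin 3 → Fin 6 → Fin 3
colour₅ a k ℓ = if does (ℓ ≟ inject₁ a) then 0F else if does (ℓ ∈? proj₁ (classes a k)) then 1F else 2F
  where open DecMembership _≟_ using (_∈?_)

colour₅-first : ∀ a k → colour₅ a k (inject₁ a) ≡ 0F
colour₅-first = from-yes (all? λ a → all? λ k → colour₅ a k (inject₁ a) ≟ 0F)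

colour₅-second : ∀ a k → All (λ ℓ → colour₅ a k ℓ ≡ 1F) (proj₁ (classes a k))
colour₅-second = from-yes (all? λ a → all? λ k →
  All.all? (λ ℓ → colour₅ a k ℓ ≟ 1F) (proj₁ (classes a k)))

colour₅-third : ∀ a k → All (λ ℓ → colour₅ a k ℓ ≡ 2F) (proj₂ (classes a k))
colour₅-third = from-yes (all? λ a → all? λ k →
  All.all? (λ ℓ → colour₅ a k ℓ ≟ 2F) (proj₂ (classes a k)))

module _ (es : Fin 7 → Triple (Fin 6)) (proper : ∀ j → Proper (es j)) where

  private
    missing : Fin 5 → ℕ
    missing ℓ = ∑[ j < 7 ] avoid (inject₁ ℓ ∷ []) (es j)

    avoids-two : ∀ t → Proper t → ∑[ ℓ < 5 ] avoid (inject₁ ℓ ∷ []) t ≤ 2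
    avoids-two = from-yes (∀-triple? λ t → proper? t →-dec ∑[ ℓ < 5 ] avoid (inject₁ ℓ ∷ []) t ≤? 2)

    total : sum missing ≤ 14
    total = double-count-≤ (λ ℓ j → avoid (inject₁ ℓ ∷ []) (es j)) 2 λ j → avoids-two (es j) (proper j)

    missing₁ missing₂ : Fin 5 → Fin 3 → Fin 7 → ℕ
    missing₁ a k j = avoid (proj₁ (classes a k)) (es j)
    missing₂ a k j = avoid (proj₂ (classes a k)) (es j)

    -- An edge leaves out two of the five names, so it avoids at most one of these six pairs.
    avoids-one-class : ∀ a t → Proper t →
      ∑[ k < 3 ] (avoid (proj₁ (classes a k)) t + avoid (proj₂ (classes a k)) t) ≤ 1
    avoids-one-class = from-yes (all? λ a → ∀-triple? λ t → proper? t →-dec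
      ∑[ k < 3 ] (avoid (proj₁ (classes a k)) t + avoid (proj₂ (classes a k)) t) ≤? 1)

    total-classes : ∀ a → ∑[ k < 3 ] (sum (missing₁ a k) ⊔ sum (missing₂ a k)) ≤ 7
    total-classes a = begin
      ∑[ k < 3 ] (sum (missing₁ a k) ⊔ sum (missing₂ a k))
        ≤⟨ sum-mono-≤ (λ k → m⊔n≤m+n (sum (missing₁ a k)) (sum (missing₂ a k))) ⟩
      ∑[ k < 3 ] (sum (missing₁ a k) + sum (missing₂ a k))
        ≡⟨ sum-cong-≗ (λ k → sym (∑-distrib-+ (missing₁ a k) (missing₂ a k))) ⟩
      ∑[ k < 3 ] ∑[ j < 7 ] (missing₁ a k j + missing₂ a k j)
        ≤⟨ double-count-≤ (λ k j → missing₁ a k j + missing₂ a k j) 1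
                          (λ j → avoids-one-class a (es j) (proper j)) ⟩
      7 ∎
      where open ≤-Reasoning

    colouring : ∀ a k → missing a ≤ 2 → sum (missing₁ a k) ≤ 2 → sum (missing₂ a k) ≤ 2 →
                MissesAtMost 2 (colour₅ a k) es
    colouring a k a-few few₁ few₂ 0F =
      ≤-trans (misses-≤-avoiding (colour₅ a k) (colour₅-first a k ∷ []) es) a-few
    colouring a k a-few few₁ few₂ 1F = ≤-trans (misses-≤-avoiding (colour₅ a k) (colour₅-second a k) es) few₁
    colouring a k a-few few₁ few₂ 2F = ≤-trans (misses-≤-avoiding (colour₅ a k) (colour₅-third a k) es) few₂

  splittable₅ : Splittable es
  splittable₅ =
    let a , a-few = pigeonhole-sum 2 missing (≤-<-trans total (from-yes (14 <? 15)))
        k , few   = pigeonhole-sum 2 (λ k → sum (missing₁ a k) ⊔ sum (missing₂ a k))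
                                     (≤-<-trans (total-classes a) (from-yes (7 <? 9)))
    in colour₅ a k , colouring a k a-few (m⊔n≤o⇒m≤o _ _ few) (m⊔n≤o⇒n≤o _ _ few)

row col : Fin 3 → Fin 6
row x = 3 ↑ʳ x
col u = u ↑ˡ 3

rows : Triple (Fin 7)
rows = inject₁ (row 0F) , inject₁ (row 1F) , inject₁ (row 2F)

colour₆ : (Fin 3 → Fin 3) → Fin 7 → Fin 3
colour₆ τ 0F = τ 0F
colour₆ τ 1F = τ 1F
colour₆ τ 2F = τ 2F
colour₆ τ 3F = 0F
colour₆ τ 4F = 1F
colour₆ τ 5F = 2F
colour₆ τ 6F = 0F

colour₆-row : ∀ τ x → colour₆ τ (inject₁ (row x)) ≡ x
colour₆-row τ 0F = refl
colour₆-row τ 1F = refl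
colour₆-row τ 2F = refl

colour₆-col : ∀ τ u → colour₆ τ (inject₁ (col u)) ≡ τ u
colour₆-col τ 0F = refl
colour₆-col τ 1F = refl
colour₆-col τ 2F = refl

row-pairs col-pairs : Fin 3 → List (Fin 6 × Fin 6)
row-pairs x = List.tabulate λ u → row x , col u
col-pairs u = List.tabulate λ o → col u , punchIn (col u) o

corner : Fin 3 → Fin 3 → List (Fin 6 × Fin 6)
corner x u = (row (punchIn x 0F) , col (punchIn u 0F)) ∷ []

row-pairs-distinct : ∀ x → All (uncurry _≢_) (row-pairs x)
row-pairs-distinct = from-yes (all? λ x → All.all? (λ ab → ¬? (proj₁ ab ≟ proj₂ ab)) (row-pairs x))

col-pairs-distinct : ∀ u → All (uncurry _≢_) (col-pairs u)
col-pairs-distinct = from-yes (all? λ u → All.all? (λ ab → ¬? (proj₁ ab ≟ proj₂ ab)) (col-pairs u))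

corner-distinct : ∀ x u → All (uncurry _≢_) (corner x u)
corner-distinct = from-yes (all? λ x → all? λ u → All.all? (λ ab → ¬? (proj₁ ab ≟ proj₂ ab)) (corner x u))

avoids-both : Fin 3 → Fin 3 → Triple (Fin 7) → ℕ
avoids-both x u = avoid (inject₁ (row x) ∷ inject₁ (col u) ∷ [])

meets-besides-rows : Fin 7 → Triple (Fin 7) → ℕ
meets-besides-rows ℓ t = 𝟙 (ℓ ∈₃? t ×-dec ¬? (t ≟₃ rows))

is-rows : Triple (Fin 7) → ℕ
is-rows t = 𝟙 (t ≟₃ rows)

-- The first edge is the row triple; it holds no (row, column) pair, so row x reaches the three columns
-- through at least two other edges, column u reaches its five neighbours through at least three edges,
-- and each 2 × 2 minor contains a covered pair. This bounds the row sums, column sums and minors of the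
-- avoidance counts by 8, 8 and 11.
row-certificate : ∀ x t → Proper t →
  2 * meets-besides-rows (inject₁ (row x)) t + 2 * is-rows t + 1 * ∑[ u < 3 ] avoids-both x u t ≤ 2
row-certificate = from-yes (all? λ x → ∀-triple? λ t → proper? t →-dec
  2 * meets-besides-rows (inject₁ (row x)) t + 2 * is-rows t + 1 * ∑[ u < 3 ] avoids-both x u t ≤? 2)

row-pairs-meet : ∀ x t → Proper t → pairsIn (row-pairs x) t ≤ 2 * meets-besides-rows (inject₁ (row x)) t
row-pairs-meet = from-yes (all? λ x → ∀-triple? λ t → proper? t →-dec
  pairsIn (row-pairs x) t ≤? 2 * meets-besides-rows (inject₁ (row x)) t)

col-certificate : ∀ u t → Proper t →
  2 * 𝟙 (inject₁ (col u) ∈₃? t) + 2 * is-rows t + 1 * ∑[ x < 3 ] avoids-both x u t ≤ 2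
col-certificate = from-yes (all? λ u → ∀-triple? λ t → proper? t →-dec
  2 * 𝟙 (inject₁ (col u) ∈₃? t) + 2 * is-rows t + 1 * ∑[ x < 3 ] avoids-both x u t ≤? 2)

col-pairs-meet : ∀ u t → Proper t → pairsIn (col-pairs u) t ≤ 2 * 𝟙 (inject₁ (col u) ∈₃? t)
col-pairs-meet = from-yes (all? λ u → ∀-triple? λ t → proper? t →-dec
  pairsIn (col-pairs u) t ≤? 2 * 𝟙 (inject₁ (col u) ∈₃? t))

block-certificate : ∀ x u t → Proper t →
  pairsIn (corner x u) t + 2 * is-rows t + 1 * ∑[ a < 2 ] ∑[ b < 2 ] avoids-both (punchIn x a) (punchIn u b) t ≤ 2
block-certificate = from-yes (all? λ x → all? λ u → ∀-triple? λ t → proper? t →-dec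
  pairsIn (corner x u) t + 2 * is-rows t + 1 * ∑[ a < 2 ] ∑[ b < 2 ] avoids-both (punchIn x a) (punchIn u b) t ≤? 2)

module _ (es : Fin 7 → Triple (Fin 7)) (proper : ∀ j → Proper (es j)) (covers : Covers es)
         (has-rows : ∃ λ j → es j ≡ rows) where

  private
    missing : Fin 3 → Fin 3 → ℕ
    missing x u = ∑[ j < 7 ] avoids-both x u (es j)

    meets-row meets-col : Fin 3 → Fin 7 → ℕ
    meets-row x j = meets-besides-rows (inject₁ (row x)) (es j)
    meets-col u j = 𝟙 (inject₁ (col u) ∈₃? es j)

    rows-count : 1 ≤ ∑[ j < 7 ] is-rows (es j)
    rows-count = let j , eq = has-rows in
      subst (_≤ ∑[ j < 7 ] is-rows (es j)) (𝟙-yes (es j ≟₃ rows) eq) (f≤sum (is-rows ∘ es) j)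

    row-degree : ∀ x → 2 ≤ sum (meets-row x)
    row-degree x = *-cancelˡ-< 2 1 _ (begin
      3                                        ≤⟨ covered-pairs covers (row-pairs x) (row-pairs-distinct x) ⟩
      ∑[ j < 7 ] pairsIn (row-pairs x) (es j)  ≤⟨ sum-mono-≤ (λ j → row-pairs-meet x (es j) (proper j)) ⟩
      ∑[ j < 7 ] (2 * meets-row x j)           ≡⟨ sym (*-distribˡ-sum 2 (meets-row x)) ⟩
      2 * sum (meets-row x)                    ∎)
      where open ≤-Reasoning

    col-degree : ∀ u → 3 ≤ sum (meets-col u)
    col-degree u = *-cancelˡ-< 2 2 _ (begin
      5                                        ≤⟨ covered-pairs covers (col-pairs u) (col-pairs-distinct u) ⟩
      ∑[ j < 7 ] pairsIn (col-pairs u) (es j)  ≤⟨ sum-mono-≤ (λ j → col-pairs-meet u (es j) (proper j)) ⟩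
      ∑[ j < 7 ] (2 * meets-col u j)           ≡⟨ sym (*-distribˡ-sum 2 (meets-col u)) ⟩
      2 * sum (meets-col u)                    ∎)
      where open ≤-Reasoning

    row-sum : ∀ x → ∑[ u < 3 ] missing x u ≤ 8
    row-sum x = subst (_≤ 8) (∑-comm (λ j u → avoids-both x u (es j)))
      (bound-by-certificate (λ j → 2 * meets-row x j + 2 * is-rows (es j)) (λ j → ∑[ u < 3 ] avoids-both x u (es j))
        2 1 6 8 (λ j → row-certificate x (es j) (proper j))
        (subst (6 ≤_) (sym (∑-+-* 2 2 (meets-row x) (is-rows ∘ es)))
          (+-mono-≤ (*-monoʳ-≤ 2 (row-degree x)) (*-monoʳ-≤ 2 rows-count)))
        (from-yes (14 <? 15)))

    col-sum : ∀ u → ∑[ x < 3 ] missing x u ≤ 8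
    col-sum u = subst (_≤ 8) (∑-comm (λ j x → avoids-both x u (es j)))
      (bound-by-certificate (λ j → 2 * meets-col u j + 2 * is-rows (es j)) (λ j → ∑[ x < 3 ] avoids-both x u (es j))
        2 1 8 8 (λ j → col-certificate u (es j) (proper j))
        (subst (8 ≤_) (sym (∑-+-* 2 2 (meets-col u) (is-rows ∘ es)))
          (+-mono-≤ (*-monoʳ-≤ 2 (col-degree u)) (*-monoʳ-≤ 2 rows-count)))
        (from-yes (14 <? 17)))

    block-sum : ∀ x u → ∑[ a < 2 ] ∑[ b < 2 ] missing (punchIn x a) (punchIn u b) ≤ 11
    block-sum x u =
      subst (_≤ 11) (trans (∑-comm (λ j a → ∑[ b < 2 ] block j a b)) (sum-cong-≗ λ a → ∑-comm (λ j → block j a)))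
      (bound-by-certificate (λ j → pairsIn (corner x u) (es j) + 2 * is-rows (es j))
                            (λ j → ∑[ a < 2 ] ∑[ b < 2 ] block j a b)
        2 1 3 11 (λ j → block-certificate x u (es j) (proper j))
        (subst (3 ≤_) (sym (trans (∑-distrib-+ (pairsIn (corner x u) ∘ es) (λ j → 2 * is-rows (es j)))
                                  (cong (sum (pairsIn (corner x u) ∘ es) +_) (sym (*-distribˡ-sum 2 (is-rows ∘ es))))))
          (+-mono-≤ (covered-pairs covers (corner x u) (corner-distinct x u)) (*-monoʳ-≤ 2 rows-count)))
        (from-yes (14 <? 15)))
      where
      block : Fin 7 → Fin 2 → Fin 2 → ℕ
      block j a b = avoids-both (punchIn x a) (punchIn u b) (es j)

    hall-condition : HallCondition (λ x u → missing x u ≤ 2)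
    hall-condition =
      (λ x → pigeonhole-sum 2 (missing x) (≤-<-trans (row-sum x) (from-yes (8 <? 9)))) ,
      (λ u → pigeonhole-sum 2 (λ x → missing x u) (≤-<-trans (col-sum u) (from-yes (8 <? 9)))) ,
      (λ x u →
        let a , few  = pigeonhole-sum 5 (λ a → ∑[ b < 2 ] missing (punchIn x a) (punchIn u b))
                                        (≤-<-trans (block-sum x u) (from-yes (11 <? 12)))
            b , few′ = pigeonhole-sum 2 (λ b → missing (punchIn x a) (punchIn u b))
                                        (≤-<-trans few (from-yes (5 <? 6)))
        in a , b , few′)

    colouring : (π : Permutation′ 3) → (∀ x → missing x (π ⟨$⟩ʳ x) ≤ 2) →
                MissesAtMost 2 (colour₆ (π ⟨$⟩ˡ_)) es
    colouring π matched x =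
      ≤-trans (misses-≤-avoiding (colour₆ τ)
                 (colour₆-row τ x ∷ trans (colour₆-col τ (π ⟨$⟩ʳ x)) (inverseˡ π) ∷ []) es)
              (matched x)
      where
      τ : Fin 3 → Fin 3
      τ = π ⟨$⟩ˡ_

  splittable₆ : Splittable es
  splittable₆ = let π , matched = hall₃ (λ x u → missing x u ≤? 2) hall-condition
                in colour₆ (π ⟨$⟩ˡ_) , colouring π matched

colour₇ : Fin 8 → Fin 3
colour₇ 0F = 0F
colour₇ 1F = 1F
colour₇ 2F = 2F
colour₇ 3F = 0F
colour₇ 4F = 1F
colour₇ _  = 2F

Crossing : Fin 3 → Fin 7 × Fin 7 → Set
Crossing c (p , q) = colour₇ (inject₁ p) ≡ c × colour₇ (inject₁ q) ≢ c
                   ⊎ colour₇ (inject₁ p) ≢ c × colour₇ (inject₁ q) ≡ c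

crossing-pairs : Fin 3 → List (Fin 7 × Fin 7)
crossing-pairs c =
  filter (λ (p , q) → toℕ p <? toℕ q ×-dec crossing? (p , q)) (cartesianProduct (allFin 7) (allFin 7))
  where
  crossing? : ∀ pq → Dec (Crossing c pq)
  crossing? (p , q) = (colour₇ (inject₁ p) ≟ c ×-dec ¬? (colour₇ (inject₁ q) ≟ c))
               ⊎-dec (¬? (colour₇ (inject₁ p) ≟ c) ×-dec colour₇ (inject₁ q) ≟ c)

crossing-distinct : ∀ c → All (uncurry _≢_) (crossing-pairs c)
crossing-distinct = from-yes (all? λ c → All.all? (λ pq → ¬? (proj₁ pq ≟ proj₂ pq)) (crossing-pairs c))

crossing-many : ∀ c → 7 * 2 < length (crossing-pairs c) + 2 * 3
crossing-many = from-yes (all? λ c → 7 * 2 <? length (crossing-pairs c) + 2 * 3)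

-- A triangle has at most two sides across a cut, and an edge missing colour c has none.
crossing-certificate : ∀ c t → RepeatsOnlyUnnamed t → pairsIn (crossing-pairs c) t + 2 * miss colour₇ c t ≤ 2
crossing-certificate = from-yes (all? λ c → ∀-triple? λ t → repeats-only-unnamed? t →-dec
  pairsIn (crossing-pairs c) t + 2 * miss colour₇ c t ≤? 2)

colour₇-misses-at-most-two : (es : Fin 7 → Triple (Fin 8)) → (∀ j → RepeatsOnlyUnnamed (es j)) → Covers es →
                             MissesAtMost 2 colour₇ es
colour₇-misses-at-most-two es repeats covers c =
  bound-by-certificate (λ j → pairsIn (crossing-pairs c) (es j)) (λ j → miss colour₇ c (es j))
    2 2 (length (crossing-pairs c)) 2 (λ j → crossing-certificate c (es j) (repeats j))
    (covered-pairs covers (crossing-pairs c) (crossing-distinct c)) (crossing-many c)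

module _ {n} (es : Fin 7 → Triple (Fin n)) (distinct : AllDistinct es) (adjacent : PairwiseAdjacent es) where
  open Labelling es

  private
    pull-back : ∀ {e} (N : Naming e) → Splittable (labelled N) → Splittable es
    pull-back N (κ , misses) = κ ∘ label N , misses

    from-naming₄ : Naming 4 → Splittable es
    from-naming₄ N = pull-back N (colour₇ , colour₇-misses-at-most-two (labelled N)
      (labelled-repeats-only-unnamed N distinct) (labelled-covers N adjacent))

    from-naming₃ : Naming 3 → Splittable es
    from-naming₃ N with complete-or-extensible N
    ... | inj₁ complete = pull-back N (splittable₆ (labelled N) (labelled-proper N distinct complete)
      (labelled-covers N adjacent) (0F , cong₂ _,_ (label-first N 0F) (cong₂ _,_ (label-first N 1F) (label-first N 2F))))
    ... | inj₂ (x , vx , x∉) = from-naming₄ (extend N vx x∉)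

    from-naming₂ : Naming 2 → Splittable es
    from-naming₂ N with complete-or-extensible N
    ... | inj₁ complete      = pull-back N (splittable₅ (labelled N) (labelled-proper N distinct complete))
    ... | inj₂ (x , vx , x∉) = from-naming₃ (extend N vx x∉)

    from-naming₁ : Naming 1 → Splittable es
    from-naming₁ N with complete-or-extensible N
    ... | inj₁ complete      = pull-back N (splittable₄ (labelled N) (labelled-proper N distinct complete))
    ... | inj₂ (x , vx , x∉) = from-naming₂ (extend N vx x∉)

    from-naming₀ : Naming 0 → Splittable es
    from-naming₀ N with complete-or-extensible N
    ... | inj₁ complete      = pull-back N (colour₃ , λ i →
      ≤-trans (colour₃-misses-nothing (labelled N) (labelled-proper N distinct complete) i) z≤n)
    ... | inj₂ (x , vx , x∉) = from-naming₁ (extend N vx x∉)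

  split-pairwise-adjacent : Splittable es
  split-pairwise-adjacent = from-naming₀ (first-edge-naming distinct)

member-with-rest : ∀ {n k} (p : Subset n) → ∣ p ∣ ≡ suc k → ∃ λ x → x ∈ p × ∣ p - x ∣ ≡ k
member-with-rest (inside  ∷ p) size = zero , here , trans (cong ∣_∣ (p─⊥≡p p)) (suc-injective size)
member-with-rest (outside ∷ p) size with member-with-rest p size
... | x , x∈p , rest = suc x , there x∈p , rest

x∉p-x : ∀ {n} (p : Subset n) x → x ∉ p - x
x∉p-x (inside  ∷ p) zero    ()
x∉p-x (outside ∷ p) zero    ()
x∉p-x (_       ∷ p) (suc x) (there x∈) = x∉p-x p x x∈

three-members : ∀ {n} (p : Subset n) → ∣ p ∣ ≡ 3 → ∃ λ t → Distinct₃ t × ∀ s → t ‼ s ∈ p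
three-members p size with member-with-rest p size
... | x , x∈p , size₂ with member-with-rest (p - x) size₂
... | y , y∈p-x , size₁ with member-with-rest (p - x - y) size₁
... | z , z∈p-x-y , _ = (x , y , z) , distinct₃ x≢y x≢z y≢z , members
  where
  z∈p-x : z ∈ p - x
  z∈p-x = p─q⊆p (p - x) _ z∈p-x-y
  x≢y : x ≢ y
  x≢y refl = x∉p-x p x y∈p-x
  x≢z : x ≢ z
  x≢z refl = x∉p-x p x z∈p-x
  y≢z : y ≢ z
  y≢z refl = x∉p-x (p - x) y z∈p-x-y
  members : ∀ s → (x , y , z) ‼ s ∈ p
  members 0F = x∈p
  members 1F = p─q⊆p p _ y∈p-x
  members 2F = p─q⊆p p _ z∈p-x

∈-part : ∀ {n} (c : Fin n → Fin 3) x → x ∈ part c (c x)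
∈-part c x = lookup⇒[]= x (part c (c x))
  (trans (lookup∘tabulate _ x) (trans (isYes≗does (c x ≟ c x)) (dec-true (c x ≟ c x) refl)))

missed-edge : ∀ {n} (c : Fin n → Fin 3) i {e : Subset n} {t} → (∀ s → t ‼ s ∈ e) →
              ¬ Meets (part c i) e → 1 ≤ miss c i t
missed-edge c i {t = t} members ¬meets = ≤-reflexive (sym (𝟙-yes (¬? (hits? c i t))
  λ { (s , refl) → ¬meets (t ‼ s , x∈p∩q⁺ (∈-part c (t ‼ s) , members s)) }))

m≤countFin+sum : ∀ {m} {P : Fin m → Set} (P? : ∀ j → Dec (P j)) (w : Fin m → ℕ) →
              (∀ j → ¬ P j → 1 ≤ w j) → m ≤ countFin P? + sum w
m≤countFin+sum {zero}  P? w heavy = z≤n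
m≤countFin+sum {suc m} P? w heavy with P? zero | m≤countFin+sum (P? ∘ suc) (w ∘ suc) (heavy ∘ suc)
... | yes _ | rest = s≤s (≤-trans rest (+-monoʳ-≤ (countFin (P? ∘ suc)) (m≤n+m (sum (w ∘ suc)) (w zero))))
... | no ¬p | rest = begin
  suc m                                           ≤⟨ s≤s rest ⟩
  suc (countFin (P? ∘ suc) + sum (w ∘ suc))       ≡⟨ sym (+-suc _ _) ⟩
  countFin (P? ∘ suc) + suc (sum (w ∘ suc))       ≤⟨ +-monoʳ-≤ _ (+-monoˡ-≤ _ (heavy zero ¬p)) ⟩
  countFin (P? ∘ suc) + (w zero + sum (w ∘ suc))  ∎
  where open ≤-Reasoning

module _ {n} (G : Hypergraph3 n 7) where

  members : ∀ j → ∃ λ t → Distinct₃ t × ∀ s → t ‼ s ∈ lookup (edge G) j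
  members j = three-members (lookup (edge G) j) (uniform G j)

  triples : Fin 7 → Triple (Fin n)
  triples j = proj₁ (members j)

  meets-five : ∀ {c} → MissesAtMost 2 c triples → ∀ i → 5 ≤ edgesMet G (part c i)
  meets-five {c} misses i = +-cancelʳ-≤ 2 5 _ (begin
    7
      ≤⟨ m≤countFin+sum (λ j → meets? (part c i) (lookup (edge G) j)) (λ j → miss c i (triples j))
                     (λ j → missed-edge c i (proj₂ (proj₂ (members j)))) ⟩
    edgesMet G (part c i) + ∑[ j < 7 ] miss c i (triples j)  ≤⟨ +-monoʳ-≤ _ (misses i) ⟩
    edgesMet G (part c i) + 2                                ∎)
    where open ≤-Reasoning

  splitting : Splittable triples
  splitting = let f , distinct , adjacent = folding triples (proj₁ ∘ proj₂ ∘ members)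
                  κ , misses = split-pairwise-adjacent (map₃ f ∘ triples) distinct adjacent
              in κ ∘ f , misses

lemma9 : (n : ℕ) (G : Hypergraph3 n 7) →
    ∃ λ (c : Fin n → Fin 3) → (i : Fin 3) → 3 * 7 ≤ 5 * edgesMet G (part c i)
lemma9 n G = let c , misses = splitting G in
  c , λ i → ≤-trans (from-yes (3 * 7 ≤? 5 * 5)) (*-monoʳ-≤ 5 (meets-five G misses i))
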